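{- For every integer $m>0$, as $N\to\infty$, $$\sum_{n=1}^N(-1)^{n+1}H_n^m=\frac{(-1)^{N+1}}{2}H_{N+1}^m+\sum_{k=0}^{m-1}\binom{m}{k}\frac{(-1)^{m-k-1}}{2}\mathcal{J}^k(m-k)+o(1).$$
   Context: $H_n=1+\frac12+\cdots+\frac1n$. For integers $k\ge0$, $\mathcal{J}^k(s)=\sum_{n\ge1}(-1)^{n+1}H_n^k n^{ -s}$ ($\Re(s)>0$); $\mathcal{J}^0$ is the Dirichlet eta function. $o(1)$ denotes a quantity tending to $0$ as $N\to\infty$. -}

module Defs where

open import Data.Nat using (ℕ; zero; suc; _∸_)
open import Data.Nat.Combinatorics using (_C_)
open import Data.Integer using (+_)
open import Data.Rational using (ℚ; 0ℚ; 1ℚ; _+_; _*_; -_; _/_; ½)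

pow : ℚ → ℕ → ℚ
pow q zero    = 1ℚ
pow q (suc k) = q * pow q k

altsign : ℕ → ℚ
altsign zero    = 1ℚ
altsign (suc n) = - altsign n

sumFrom1 : ℕ → (ℕ → ℚ) → ℚ
sumFrom1 zero    f = 0ℚ
sumFrom1 (suc N) f = sumFrom1 N f + f (suc N)

sumBelow : ℕ → (ℕ → ℚ) → ℚ
sumBelow zero    f = 0ℚ
sumBelow (suc m) f = sumBelow m f + f m

H : ℕ → ℚ
H n = sumFrom1 n (λ { zero → 0ℚ ; (suc i) → + 1 / suc i })

-- n^{-s} for n ≥ 1 (value at n = 0 is irrelevant; never used)
invPow : ℕ → ℕ → ℚ
invPow zero    s = 0ℚ
invPow (suc i) s = pow (+ 1 / suc i) s

-- M-th partial sum of J^k(s) = Σ_{n≥1} (-1)^{n+1} H_n^k n^{-s}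
Jpartial : ℕ → ℕ → ℕ → ℚ
Jpartial k s M = sumFrom1 M (λ n → altsign (suc n) * pow (H n) k * invPow n s)

altHarmSum : ℕ → ℕ → ℚ
altHarmSum m N = sumFrom1 N (λ n → altsign (suc n) * pow (H n) m)

constPartial : ℕ → ℕ → ℚ
constPartial m M =
  sumBelow m (λ k → (+ (m C k) / 1) * altsign (m ∸ k ∸ 1) * ½ * Jpartial k (m ∸ k) M)

mainTerm : ℕ → ℕ → ℚ
mainTerm m N = altsign (suc N) * ½ * pow (H (suc N)) m

{-# OPTIONS --safe #-}
module Submission where

-- Let E_N = Σ_{n ≤ N} (-1)^{n+1} H_n^m - (-1)^{N+1} H_{N+1}^m / 2 (`regularised m N`) and
-- Δ_j = H_{j+1}^m - H_j^m, so that E_{N+1} = E_N + (-1)^{N+1} Δ_{N+1} / 2.  Expanding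
-- Δ_L = H_{L+1}^m - (H_{L+1} - 1/(L+1))^m binomially shows that the (L+1)-st summand of the
-- constant is exactly (-1)^L Δ_L / 2, so its M-th partial sum is E_{M-1} and the theorem says
-- that E is a Cauchy sequence.  As E is the sequence of partial sums of an alternating series,
-- it suffices that Δ_j eventually decreases and tends to 0.  Both follow from the mean value
-- bounds m u H_j^{m-1} ≤ Δ_j ≤ m u H_{j+1}^{m-1}, u = 1/(j+1): once H_j > 4(m-1) (which happens,
-- as H_{2^i} ≥ i/2) the upper bound for Δ_{j+1} is below the lower bound for Δ_j, and since
-- H_{2^i} ≤ i + 1 the upper bound at j + 1 = 2^i is at most m (i+1)^{m-1} / 2^i.

open import Defs
open import Algebra.Bundles using (CommutativeRing; CommutativeSemiring)
open import Data.Fin using (Fin; toℕ)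
open import Data.Integer as ℤ using (1ℤ)
import Data.Integer.Properties as ℤ
import Data.Integer.Tactic.RingSolver as ℤ-Solver
open import Data.Nat as ℕ using (ℕ; zero; suc; _∸_; z≤n; s≤s; _≥_)
open import Data.Nat.Combinatorics using (_C_; nCn≡1)
import Data.Nat.Properties as ℕ
import Data.Nat.Tactic.RingSolver as ℕ-Solver
open import Data.Product using (∃; _,_; _×_; proj₁; proj₂)
open import Data.Rational hiding (_≥_)
open import Data.Rational.Properties
import Data.Rational.Unnormalised as ℚᵘ
import Data.Rational.Unnormalised.Properties as ℚᵘ
open import Data.Sum using (inj₁; inj₂)
open import Level using (0ℓ)
open import Relation.Binary.PropositionalEquality
open import Relation.Nullary.Decidable using (dec⇒maybe)
open import Tactic.RingSolver using (solve-∀)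
import Tactic.RingSolver.Core.AlmostCommutativeRing as ACR

ℚ-ring : ACR.AlmostCommutativeRing 0ℓ 0ℓ
ℚ-ring = ACR.fromCommutativeRing +-*-commutativeRing (λ p → dec⇒maybe (0ℚ ≟ p))

open CommutativeRing +-*-commutativeRing using (commutativeSemiring)
import Algebra.Properties.CommutativeSemiring.Binomial commutativeSemiring as Binomial
open import Algebra.Definitions.RawSemiring (CommutativeSemiring.rawSemiring commutativeSemiring)
  using (_^_; sum) renaming (_×_ to _·_)

fromℕ : ℕ → ℚ
fromℕ n = ℤ.+ n / 1

unitFrac : ℕ → ℚ
unitFrac n = ℤ.+ 1 / suc n

toℚᵘ-fromℕ : ∀ n → toℚᵘ (fromℕ n) ℚᵘ.≃ ℚᵘ.mkℚᵘ (ℤ.+ n) 0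
toℚᵘ-fromℕ n = toℚᵘ-fromℚᵘ (ℚᵘ.mkℚᵘ (ℤ.+ n) 0)

toℚᵘ-unitFrac : ∀ n → toℚᵘ (unitFrac n) ℚᵘ.≃ ℚᵘ.mkℚᵘ (ℤ.+ 1) n
toℚᵘ-unitFrac n = toℚᵘ-fromℚᵘ (ℚᵘ.mkℚᵘ (ℤ.+ 1) n)

fromℕ-+ : ∀ a b → fromℕ (a ℕ.+ b) ≡ fromℕ a + fromℕ b
fromℕ-+ a b = toℚᵘ-injective (begin
  toℚᵘ (fromℕ (a ℕ.+ b))                    ≈⟨ toℚᵘ-fromℕ (a ℕ.+ b) ⟩
  ℚᵘ.mkℚᵘ (ℤ.+ a ℤ.+ ℤ.+ b) 0               ≈⟨ ℚᵘ.*≡* (sum-over-1 (ℤ.+ a) (ℤ.+ b)) ⟩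
  ℚᵘ.mkℚᵘ (ℤ.+ a) 0 ℚᵘ.+ ℚᵘ.mkℚᵘ (ℤ.+ b) 0  ≈⟨ ℚᵘ.+-cong (toℚᵘ-fromℕ a) (toℚᵘ-fromℕ b) ⟨
  toℚᵘ (fromℕ a) ℚᵘ.+ toℚᵘ (fromℕ b)        ≈⟨ toℚᵘ-homo-+ (fromℕ a) (fromℕ b) ⟨
  toℚᵘ (fromℕ a + fromℕ b)                  ∎)
  where
  open ℚᵘ.≃-Reasoning
  sum-over-1 : ∀ x y → (x ℤ.+ y) ℤ.* (1ℤ ℤ.* 1ℤ) ≡ (x ℤ.* 1ℤ ℤ.+ y ℤ.* 1ℤ) ℤ.* 1ℤ
  sum-over-1 = ℤ-Solver.solve-∀

fromℕ-suc : ∀ n → fromℕ (suc n) ≡ 1ℚ + fromℕ n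
fromℕ-suc = fromℕ-+ 1

fromℕ-* : ∀ a b → fromℕ (a ℕ.* b) ≡ fromℕ a * fromℕ b
fromℕ-* zero    b = sym (*-zeroˡ (fromℕ b))
fromℕ-* (suc a) b = begin
  fromℕ (b ℕ.+ a ℕ.* b)        ≡⟨ fromℕ-+ b (a ℕ.* b) ⟩
  fromℕ b + fromℕ (a ℕ.* b)    ≡⟨ cong (fromℕ b +_) (fromℕ-* a b) ⟩
  fromℕ b + fromℕ a * fromℕ b  ≡⟨ distrib (fromℕ a) (fromℕ b) ⟩
  (1ℚ + fromℕ a) * fromℕ b     ≡⟨ cong (_* fromℕ b) (sym (fromℕ-suc a)) ⟩
  fromℕ (suc a) * fromℕ b      ∎
  where
  open ≡-Reasoning
  distrib : ∀ x y → y + x * y ≡ (1ℚ + x) * y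
  distrib = solve-∀ ℚ-ring

fromℕ-^ : ∀ a k → fromℕ (a ℕ.^ k) ≡ pow (fromℕ a) k
fromℕ-^ a zero    = refl
fromℕ-^ a (suc k) = trans (fromℕ-* a (a ℕ.^ k)) (cong (fromℕ a *_) (fromℕ-^ a k))

fromℕ-mono-≤ : ∀ {a b} → a ℕ.≤ b → fromℕ a ≤ fromℕ b
fromℕ-mono-≤ {a} {b} a≤b = toℚᵘ-cancel-≤ (begin
  toℚᵘ (fromℕ a)     ≃⟨ toℚᵘ-fromℕ a ⟩
  ℚᵘ.mkℚᵘ (ℤ.+ a) 0  ≤⟨ ℚᵘ.*≤* (ℤ.*-monoʳ-≤-nonNeg 1ℤ (ℤ.+≤+ a≤b)) ⟩
  ℚᵘ.mkℚᵘ (ℤ.+ b) 0  ≃⟨ toℚᵘ-fromℕ b ⟨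
  toℚᵘ (fromℕ b)     ∎)
  where open ℚᵘ.≤-Reasoning

fromℕ-mono-< : ∀ {a b} → a ℕ.< b → fromℕ a < fromℕ b
fromℕ-mono-< {a} {b} a<b = toℚᵘ-cancel-< (begin-strict
  toℚᵘ (fromℕ a)     ≃⟨ toℚᵘ-fromℕ a ⟩
  ℚᵘ.mkℚᵘ (ℤ.+ a) 0  <⟨ ℚᵘ.*<* (ℤ.*-monoʳ-<-pos 1ℤ (ℤ.+<+ a<b)) ⟩
  ℚᵘ.mkℚᵘ (ℤ.+ b) 0  ≃⟨ toℚᵘ-fromℕ b ⟨
  toℚᵘ (fromℕ b)     ∎)
  where open ℚᵘ.≤-Reasoning

fromℕ-nonNeg : ∀ n → 0ℚ ≤ fromℕ n
fromℕ-nonNeg n = fromℕ-mono-≤ {0} {n} z≤n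

unitFrac-inverse : ∀ n → unitFrac n * fromℕ (suc n) ≡ 1ℚ
unitFrac-inverse n = toℚᵘ-injective (begin
  toℚᵘ (unitFrac n * fromℕ (suc n))             ≈⟨ toℚᵘ-homo-* (unitFrac n) (fromℕ (suc n)) ⟩
  toℚᵘ (unitFrac n) ℚᵘ.* toℚᵘ (fromℕ (suc n))   ≈⟨ ℚᵘ.*-cong (toℚᵘ-unitFrac n) (toℚᵘ-fromℕ (suc n)) ⟩
  ℚᵘ.mkℚᵘ (ℤ.+ 1) n ℚᵘ.* ℚᵘ.mkℚᵘ (ℤ.+ suc n) 0  ≈⟨ ℚᵘ.*≡* (cancel (ℤ.+ suc n)) ⟩
  toℚᵘ 1ℚ                                       ∎)
  where
  open ℚᵘ.≃-Reasoning
  cancel : ∀ x → (1ℤ ℤ.* x) ℤ.* 1ℤ ≡ 1ℤ ℤ.* (x ℤ.* 1ℤ)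
  cancel = ℤ-Solver.solve-∀

unitFrac-pos : ∀ n → 0ℚ < unitFrac n
unitFrac-pos n = toℚᵘ-cancel-< (ℚᵘ.<-respʳ-≃ (ℚᵘ.≃-sym (toℚᵘ-unitFrac n)) (ℚᵘ.*<* (ℤ.+<+ (s≤s z≤n))))

unitFrac-nonNeg : ∀ n → 0ℚ ≤ unitFrac n
unitFrac-nonNeg n = <⇒≤ (unitFrac-pos n)

unitFrac-antimono-≤ : ∀ {m n} → m ℕ.≤ n → unitFrac n ≤ unitFrac m
unitFrac-antimono-≤ {m} {n} m≤n = toℚᵘ-cancel-≤ (begin
  toℚᵘ (unitFrac n)  ≃⟨ toℚᵘ-unitFrac n ⟩
  ℚᵘ.mkℚᵘ (ℤ.+ 1) n  ≤⟨ ℚᵘ.*≤* (ℤ.*-monoˡ-≤-nonNeg 1ℤ (ℤ.+≤+ (s≤s m≤n))) ⟩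
  ℚᵘ.mkℚᵘ (ℤ.+ 1) m  ≃⟨ toℚᵘ-unitFrac m ⟨
  toℚᵘ (unitFrac m)  ∎)
  where open ℚᵘ.≤-Reasoning

unitFrac≤1 : ∀ n → unitFrac n ≤ 1ℚ
unitFrac≤1 n = unitFrac-antimono-≤ {0} {n} z≤n

unitFrac-difference : ∀ j → unitFrac j - unitFrac (suc j) ≡ unitFrac j * unitFrac (suc j)
unitFrac-difference j = begin
  U - v                                               ≡⟨ expand U v P ⟩
  U * v + v * (U * P - 1ℚ) - U * (v * (1ℚ + P) - 1ℚ)  ≡⟨ cong₂ (λ x y → U * v + v * (x - 1ℚ) - U * (y - 1ℚ)) (unitFrac-inverse j) v*[1+P]≡1 ⟩
  U * v + v * (1ℚ - 1ℚ) - U * (1ℚ - 1ℚ)               ≡⟨ cancel U v ⟩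
  U * v                                               ∎
  where
  open ≡-Reasoning
  U = unitFrac j
  v = unitFrac (suc j)
  P = fromℕ (suc j)
  v*[1+P]≡1 : v * (1ℚ + P) ≡ 1ℚ
  v*[1+P]≡1 = trans (cong (v *_) (sym (fromℕ-suc (suc j)))) (unitFrac-inverse (suc j))
  expand : ∀ U v P → U - v ≡ U * v + v * (U * P - 1ℚ) - U * (v * (1ℚ + P) - 1ℚ)
  expand = solve-∀ ℚ-ring
  cancel : ∀ U v → U * v + v * (1ℚ - 1ℚ) - U * (1ℚ - 1ℚ) ≡ U * v
  cancel = solve-∀ ℚ-ring

+-nonNeg : ∀ {p q} → 0ℚ ≤ p → 0ℚ ≤ q → 0ℚ ≤ p + q
+-nonNeg = +-mono-≤

*-nonNeg : ∀ {p q} → 0ℚ ≤ p → 0ℚ ≤ q → 0ℚ ≤ p * q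
*-nonNeg {p} {q} 0≤p 0≤q =
  nonNegative⁻¹ (p * q) {{nonNeg*nonNeg⇒nonNeg p {{nonNegative 0≤p}} q {{nonNegative 0≤q}}}}

*-monoˡ-≤-0≤ : ∀ {r p q} → 0ℚ ≤ r → p ≤ q → r * p ≤ r * q
*-monoˡ-≤-0≤ {r} 0≤r = *-monoˡ-≤-nonNeg r {{nonNegative 0≤r}}

*-monoʳ-≤-0≤ : ∀ {r p q} → 0ℚ ≤ r → p ≤ q → p * r ≤ q * r
*-monoʳ-≤-0≤ {r} 0≤r = *-monoʳ-≤-nonNeg r {{nonNegative 0≤r}}

*-cancelˡ-≤-0< : ∀ {r p q} → 0ℚ < r → r * p ≤ r * q → p ≤ q
*-cancelˡ-≤-0< {r} 0<r = *-cancelˡ-≤-pos r {{positive 0<r}}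

p≤p+q : ∀ {p q} → 0ℚ ≤ q → p ≤ p + q
p≤p+q {p} 0≤q = subst (_≤ p + _) (+-identityʳ p) (+-monoʳ-≤ p 0≤q)

p≤q⇒0≤q-p : ∀ {p q} → p ≤ q → 0ℚ ≤ q - p
p≤q⇒0≤q-p {p} {q} p≤q = subst (_≤ q - p) (+-inverseʳ p) (+-monoˡ-≤ (- p) p≤q)

p≤q+r⇒p-q≤r : ∀ {p q r} → p ≤ q + r → p - q ≤ r
p≤q+r⇒p-q≤r {p} {q} {r} p≤q+r = subst (p - q ≤_) (cancel q r) (+-monoˡ-≤ (- q) p≤q+r)
  where
  cancel : ∀ x y → x + y - x ≡ y
  cancel = solve-∀ ℚ-ring

q+r≤p⇒r≤p-q : ∀ {p q r} → q + r ≤ p → r ≤ p - q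
q+r≤p⇒r≤p-q {p} {q} {r} q+r≤p = subst (_≤ p - q) (cancel q r) (+-monoˡ-≤ (- q) q+r≤p)
  where
  cancel : ∀ x y → x + y - x ≡ y
  cancel = solve-∀ ℚ-ring

pow-nonNeg : ∀ {x} k → 0ℚ ≤ x → 0ℚ ≤ pow x k
pow-nonNeg zero    0≤x = *≤* (ℤ.+≤+ z≤n)
pow-nonNeg (suc k) 0≤x = *-nonNeg 0≤x (pow-nonNeg k 0≤x)

pow-mono-≤ : ∀ {x y} k → 0ℚ ≤ x → x ≤ y → pow x k ≤ pow y k
pow-mono-≤         zero    0≤x x≤y = ≤-refl
pow-mono-≤ {x} {y} (suc k) 0≤x x≤y = begin
  x * pow x k  ≤⟨ *-monoʳ-≤-0≤ (pow-nonNeg k 0≤x) x≤y ⟩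
  y * pow x k  ≤⟨ *-monoˡ-≤-0≤ (≤-trans 0≤x x≤y) (pow-mono-≤ k 0≤x x≤y) ⟩
  y * pow y k  ∎
  where open ≤-Reasoning

pow-neg : ∀ x j → pow (- x) j ≡ altsign j * pow x j
pow-neg x zero    = refl
pow-neg x (suc j) = trans (cong (- x *_) (pow-neg x j)) (swap-sign x (altsign j) (pow x j))
  where
  swap-sign : ∀ x s p → - x * (s * p) ≡ - s * (x * p)
  swap-sign = solve-∀ ℚ-ring

altsign-+ : ∀ m n → altsign (m ℕ.+ n) ≡ altsign m * altsign n
altsign-+ zero    n = sym (*-identityˡ (altsign n))
altsign-+ (suc m) n = trans (cong -_ (altsign-+ m n)) (neg-distribˡ-* (altsign m) (altsign n))

∣altsign∣≡1 : ∀ n → ∣ altsign n ∣ ≡ 1ℚ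
∣altsign∣≡1 zero    = refl
∣altsign∣≡1 (suc n) = trans (∣-p∣≡∣p∣ (altsign n)) (∣altsign∣≡1 n)

∣p-q∣≡∣q-p∣ : ∀ p q → ∣ p - q ∣ ≡ ∣ q - p ∣
∣p-q∣≡∣q-p∣ p q = trans (cong ∣_∣ (negate p q)) (∣-p∣≡∣p∣ (q - p))
  where
  negate : ∀ p q → p - q ≡ - (q - p)
  negate = solve-∀ ℚ-ring

-- Finite sums and the binomial theorem

sumBelow-cong : ∀ n {f g : ℕ → ℚ} → (∀ i → i ℕ.< n → f i ≡ g i) → sumBelow n f ≡ sumBelow n g
sumBelow-cong zero    f≡g = refl
sumBelow-cong (suc n) f≡g = cong₂ _+_ (sumBelow-cong n (λ i i<n → f≡g i (ℕ.m≤n⇒m≤1+n i<n))) (f≡g n ℕ.≤-refl)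

sumBelow-+ : ∀ n (f g : ℕ → ℚ) → sumBelow n (λ i → f i + g i) ≡ sumBelow n f + sumBelow n g
sumBelow-+ zero    f g = refl
sumBelow-+ (suc n) f g = trans (cong (_+ (f n + g n)) (sumBelow-+ n f g)) (interchange (sumBelow n f) (sumBelow n g) (f n) (g n))
  where
  interchange : ∀ a b c d → a + b + (c + d) ≡ a + c + (b + d)
  interchange = solve-∀ ℚ-ring

sumBelow-*ˡ : ∀ n c (f : ℕ → ℚ) → sumBelow n (λ i → c * f i) ≡ c * sumBelow n f
sumBelow-*ˡ zero    c f = sym (*-zeroʳ c)
sumBelow-*ˡ (suc n) c f = trans (cong (_+ c * f n) (sumBelow-*ˡ n c f)) (sym (*-distribˡ-+ c (sumBelow n f) (f n)))

sumBelow-neg : ∀ n (f : ℕ → ℚ) → sumBelow n (λ i → - f i) ≡ - sumBelow n f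
sumBelow-neg n f = begin
  sumBelow n (λ i → - f i)       ≡⟨ sumBelow-cong n (λ i _ → neg≡-1* (f i)) ⟩
  sumBelow n (λ i → - 1ℚ * f i)  ≡⟨ sumBelow-*ˡ n (- 1ℚ) f ⟩
  - 1ℚ * sumBelow n f            ≡⟨ neg≡-1* (sumBelow n f) ⟨
  - sumBelow n f                 ∎
  where
  open ≡-Reasoning
  neg≡-1* : ∀ x → - x ≡ - 1ℚ * x
  neg≡-1* = solve-∀ ℚ-ring

sumBelow-0 : ∀ n → sumBelow n (λ _ → 0ℚ) ≡ 0ℚ
sumBelow-0 zero    = refl
sumBelow-0 (suc n) = trans (+-identityʳ _) (sumBelow-0 n)

sumBelow-suc : ∀ n (f : ℕ → ℚ) → sumBelow (suc n) f ≡ f 0 + sumBelow n (λ i → f (suc i))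
sumBelow-suc zero    f = trans (+-identityˡ (f 0)) (sym (+-identityʳ (f 0)))
sumBelow-suc (suc n) f = trans (cong (_+ f (suc n)) (sumBelow-suc n f)) (+-assoc (f 0) _ (f (suc n)))

sum≡sumBelow : ∀ n (f : ℕ → ℚ) → sum (λ (i : Fin n) → f (toℕ i)) ≡ sumBelow n f
sum≡sumBelow zero    f = refl
sum≡sumBelow (suc n) f = trans (cong (f 0 +_) (sum≡sumBelow n (λ i → f (suc i)))) (sym (sumBelow-suc n f))

pow≡^ : ∀ x n → pow x n ≡ x ^ n
pow≡^ x zero    = refl
pow≡^ x (suc n) = cong (x *_) (pow≡^ x n)

·≡fromℕ* : ∀ n x → n · x ≡ fromℕ n * x
·≡fromℕ* zero    x = sym (*-zeroˡ x)
·≡fromℕ* (suc n) x = begin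
  x + n · x           ≡⟨ cong (x +_) (·≡fromℕ* n x) ⟩
  x + fromℕ n * x     ≡⟨ distrib (fromℕ n) x ⟩
  (1ℚ + fromℕ n) * x  ≡⟨ cong (_* x) (fromℕ-suc n) ⟨
  fromℕ (suc n) * x   ∎
  where
  open ≡-Reasoning
  distrib : ∀ c x → x + c * x ≡ (1ℚ + c) * x
  distrib = solve-∀ ℚ-ring

binomial-theorem : ∀ n x y → pow (x + y) n ≡ sumBelow (suc n) (λ i → fromℕ (n C i) * (pow x i * pow y (n ∸ i)))
binomial-theorem n x y = begin
  pow (x + y) n                                                            ≡⟨ pow≡^ (x + y) n ⟩
  (x + y) ^ n                                                              ≡⟨ Binomial.theorem n x y ⟩
  sum (λ (i : Fin (suc n)) → (n C toℕ i) · (x ^ toℕ i * y ^ (n ∸ toℕ i)))  ≡⟨ sum≡sumBelow (suc n) (λ i → (n C i) · (x ^ i * y ^ (n ∸ i))) ⟩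
  sumBelow (suc n) (λ i → (n C i) · (x ^ i * y ^ (n ∸ i)))                 ≡⟨ sumBelow-cong (suc n) (λ i _ → term i) ⟩
  sumBelow (suc n) (λ i → fromℕ (n C i) * (pow x i * pow y (n ∸ i)))       ∎
  where
  open ≡-Reasoning
  term : ∀ i → (n C i) · (x ^ i * y ^ (n ∸ i)) ≡ fromℕ (n C i) * (pow x i * pow y (n ∸ i))
  term i = trans (·≡fromℕ* (n C i) _) (cong₂ (λ p q → fromℕ (n C i) * (p * q)) (sym (pow≡^ x i)) (sym (pow≡^ y (n ∸ i))))

binomial-difference : ∀ k X U →
  sumBelow (suc k) (λ i → fromℕ (suc k C i) * altsign (suc k ∸ i ∸ 1) * pow X i * pow U (suc k ∸ i))
    ≡ pow X (suc k) - pow (X - U) (suc k)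
binomial-difference k X U = begin
  S                          ≡⟨ rearrange S (pow X m) ⟩
  pow X m - (- S + pow X m)  ≡⟨ cong (_-_ (pow X m)) expansion ⟨
  pow X m - pow (X - U) m    ∎
  where
  open ≡-Reasoning
  m = suc k
  f : ℕ → ℚ
  f i = fromℕ (m C i) * altsign (m ∸ i ∸ 1) * pow X i * pow U (m ∸ i)
  S = sumBelow m f
  rearrange : ∀ s p → s ≡ p - (- s + p)
  rearrange = solve-∀ ℚ-ring
  negate : ∀ c x s p → c * (x * (- s * p)) ≡ - (c * s * x * p)
  negate = solve-∀ ℚ-ring
  lower-term : ∀ i → i ℕ.< m → fromℕ (m C i) * (pow X i * pow (- U) (m ∸ i)) ≡ - f i
  lower-term i (s≤s i≤k) = begin
    fromℕ (m C i) * (pow X i * pow (- U) (m ∸ i))                    ≡⟨ cong (λ p → fromℕ (m C i) * (pow X i * p)) (pow-neg U (m ∸ i)) ⟩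
    fromℕ (m C i) * (pow X i * (altsign (m ∸ i) * pow U (m ∸ i)))    ≡⟨ cong (λ n → fromℕ (m C i) * (pow X i * (altsign n * pow U (m ∸ i)))) m∸i≡suc[k∸i] ⟩
    fromℕ (m C i) * (pow X i * (- altsign (k ∸ i) * pow U (m ∸ i)))  ≡⟨ negate (fromℕ (m C i)) (pow X i) (altsign (k ∸ i)) (pow U (m ∸ i)) ⟩
    - (fromℕ (m C i) * altsign (k ∸ i) * pow X i * pow U (m ∸ i))    ≡⟨ cong (λ n → - (fromℕ (m C i) * altsign n * pow X i * pow U (m ∸ i))) (cong (_∸ 1) m∸i≡suc[k∸i]) ⟨
    - f i                                                            ∎
    where
    m∸i≡suc[k∸i] : m ∸ i ≡ suc (k ∸ i)
    m∸i≡suc[k∸i] = ℕ.+-∸-assoc 1 i≤k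
  top-term : fromℕ (m C m) * (pow X m * pow (- U) (m ∸ m)) ≡ pow X m
  top-term = begin
    fromℕ (m C m) * (pow X m * pow (- U) (m ∸ m))  ≡⟨ cong₂ (λ c n → fromℕ c * (pow X m * pow (- U) n)) (nCn≡1 m) (ℕ.n∸n≡0 m) ⟩
    1ℚ * (pow X m * 1ℚ)                            ≡⟨ unit (pow X m) ⟩
    pow X m                                        ∎
    where
    unit : ∀ x → 1ℚ * (x * 1ℚ) ≡ x
    unit = solve-∀ ℚ-ring
  expansion : pow (X - U) m ≡ - S + pow X m
  expansion = begin
    pow (X + - U) m                                    ≡⟨ binomial-theorem m X (- U) ⟩
    sumBelow m (λ i → fromℕ (m C i) * (pow X i * pow (- U) (m ∸ i)))
      + fromℕ (m C m) * (pow X m * pow (- U) (m ∸ m))  ≡⟨ cong₂ _+_ (sumBelow-cong m lower-term) top-term ⟩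
    sumBelow m (λ i → - f i) + pow X m                 ≡⟨ cong (_+ pow X m) (sumBelow-neg m f) ⟩
    - S + pow X m                                      ∎

-- Harmonic numbers

-- H (suc n) reduces to H n + unitFrac n, which the proofs below use silently.

H-nonNeg : ∀ n → 0ℚ ≤ H n
H-nonNeg zero    = ≤-refl
H-nonNeg (suc n) = +-nonNeg (H-nonNeg n) (unitFrac-nonNeg n)

H-mono-≤ : ∀ {m n} → m ℕ.≤ n → H m ≤ H n
H-mono-≤ {m} m≤n = go (ℕ.≤⇒≤′ m≤n)
  where
  go : ∀ {n} → m ℕ.≤′ n → H m ≤ H n
  go ℕ.≤′-refl          = ≤-refl
  go (ℕ.≤′-step {n} p) = ≤-trans (go p) (p≤p+q (unitFrac-nonNeg n))

H-+-≤ : ∀ t n → H (t ℕ.+ n) ≤ H n + fromℕ t * unitFrac n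
H-+-≤ zero    n = ≤-reflexive (no-terms (H n) (unitFrac n))
  where
  no-terms : ∀ h v → h ≡ h + 0ℚ * v
  no-terms = solve-∀ ℚ-ring
H-+-≤ (suc t) n = begin
  H (t ℕ.+ n) + unitFrac (t ℕ.+ n)         ≤⟨ +-mono-≤ (H-+-≤ t n) (unitFrac-antimono-≤ (ℕ.m≤n+m n t)) ⟩
  H n + fromℕ t * unitFrac n + unitFrac n  ≡⟨ one-more (H n) (fromℕ t) (unitFrac n) ⟩
  H n + (1ℚ + fromℕ t) * unitFrac n        ≡⟨ cong (λ c → H n + c * unitFrac n) (sym (fromℕ-suc t)) ⟩
  H n + fromℕ (suc t) * unitFrac n         ∎
  where
  open ≤-Reasoning
  one-more : ∀ h c v → h + c * v + v ≡ h + (1ℚ + c) * v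
  one-more = solve-∀ ℚ-ring

H-+-≥ : ∀ t n → H (suc n) + fromℕ t * unitFrac (t ℕ.+ n) ≤ H (t ℕ.+ suc n)
H-+-≥ zero    n = ≤-reflexive (no-terms (H (suc n)) (unitFrac n))
  where
  no-terms : ∀ h v → h + 0ℚ * v ≡ h
  no-terms = solve-∀ ℚ-ring
H-+-≥ (suc t) n = begin
  H (suc n) + fromℕ (suc t) * v                 ≡⟨ cong (λ c → H (suc n) + c * v) (fromℕ-suc t) ⟩
  H (suc n) + (1ℚ + fromℕ t) * v                ≡⟨ one-more (H (suc n)) (fromℕ t) v ⟩
  H (suc n) + fromℕ t * v + v                   ≤⟨ +-monoˡ-≤ v (+-monoʳ-≤ (H (suc n)) v≤) ⟩
  H (suc n) + fromℕ t * unitFrac (t ℕ.+ n) + v  ≤⟨ +-mono-≤ (H-+-≥ t n) (≤-reflexive (cong unitFrac (sym (ℕ.+-suc t n)))) ⟩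
  H (t ℕ.+ suc n) + unitFrac (t ℕ.+ suc n)      ∎
  where
  open ≤-Reasoning
  v = unitFrac (suc t ℕ.+ n)
  v≤ : fromℕ t * v ≤ fromℕ t * unitFrac (t ℕ.+ n)
  v≤ = *-monoˡ-≤-0≤ (fromℕ-nonNeg t) (unitFrac-antimono-≤ (ℕ.n≤1+n (t ℕ.+ n)))
  one-more : ∀ h c v → h + (1ℚ + c) * v ≡ h + c * v + v
  one-more = solve-∀ ℚ-ring

H-double-≤ : ∀ n → H (n ℕ.+ n) ≤ H n + 1ℚ
H-double-≤ n = ≤-trans (H-+-≤ n n) (+-monoʳ-≤ (H n) n/[n+1]≤1)
  where
  n/[n+1]≤1 : fromℕ n * unitFrac n ≤ 1ℚ
  n/[n+1]≤1 = begin
    fromℕ n * unitFrac n        ≤⟨ *-monoʳ-≤-0≤ (unitFrac-nonNeg n) (fromℕ-mono-≤ (ℕ.n≤1+n n)) ⟩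
    fromℕ (suc n) * unitFrac n  ≡⟨ *-comm (fromℕ (suc n)) (unitFrac n) ⟩
    unitFrac n * fromℕ (suc n)  ≡⟨ unitFrac-inverse n ⟩
    1ℚ                          ∎
    where open ≤-Reasoning

H-double-≥ : ∀ n → 0 ℕ.< n → H n + ½ ≤ H (n ℕ.+ n)
H-double-≥ (suc n) _ = subst (λ x → H (suc n) + x ≤ H (suc n ℕ.+ suc n)) half (H-+-≥ (suc n) n)
  where
  v = unitFrac (suc n ℕ.+ n)
  halve : ∀ a v → a * v ≡ ½ * (v * (a + a))
  halve = solve-∀ ℚ-ring
  half : fromℕ (suc n) * v ≡ ½
  half = begin
    fromℕ (suc n) * v                          ≡⟨ halve (fromℕ (suc n)) v ⟩
    ½ * (v * (fromℕ (suc n) + fromℕ (suc n)))  ≡⟨ cong (λ x → ½ * (v * x)) (sym (fromℕ-+ (suc n) (suc n))) ⟩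
    ½ * (v * fromℕ (suc n ℕ.+ suc n))          ≡⟨ cong (λ x → ½ * (v * fromℕ x)) (ℕ.+-suc (suc n) n) ⟩
    ½ * (v * fromℕ (suc (suc n ℕ.+ n)))        ≡⟨ cong (½ *_) (unitFrac-inverse (suc n ℕ.+ n)) ⟩
    ½                                          ∎
    where open ≡-Reasoning

2^-suc : ∀ i → 2 ℕ.^ suc i ≡ 2 ℕ.^ i ℕ.+ 2 ℕ.^ i
2^-suc i = cong (2 ℕ.^ i ℕ.+_) (ℕ.+-identityʳ (2 ℕ.^ i))

H-2^-≤ : ∀ i → H (2 ℕ.^ i) ≤ fromℕ (suc i)
H-2^-≤ zero    = ≤-refl
H-2^-≤ (suc i) = begin
  H (2 ℕ.^ suc i)          ≡⟨ cong H (2^-suc i) ⟩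
  H (2 ℕ.^ i ℕ.+ 2 ℕ.^ i)  ≤⟨ H-double-≤ (2 ℕ.^ i) ⟩
  H (2 ℕ.^ i) + 1ℚ         ≤⟨ +-monoˡ-≤ 1ℚ (H-2^-≤ i) ⟩
  fromℕ (suc i) + 1ℚ       ≡⟨ +-comm (fromℕ (suc i)) 1ℚ ⟩
  1ℚ + fromℕ (suc i)       ≡⟨ fromℕ-suc (suc i) ⟨
  fromℕ (suc (suc i))      ∎
  where open ≤-Reasoning

H-2^-≥ : ∀ i → fromℕ i * ½ ≤ H (2 ℕ.^ i)
H-2^-≥ zero    = *≤* (ℤ.+≤+ z≤n)
H-2^-≥ (suc i) = begin
  fromℕ (suc i) * ½        ≡⟨ cong (_* ½) (fromℕ-suc i) ⟩
  (1ℚ + fromℕ i) * ½       ≡⟨ distrib (fromℕ i) ⟩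
  fromℕ i * ½ + ½          ≤⟨ +-monoˡ-≤ ½ (H-2^-≥ i) ⟩
  H (2 ℕ.^ i) + ½          ≤⟨ H-double-≥ (2 ℕ.^ i) (ℕ.m^n>0 2 i) ⟩
  H (2 ℕ.^ i ℕ.+ 2 ℕ.^ i)  ≡⟨ cong H (2^-suc i) ⟨
  H (2 ℕ.^ suc i)          ∎
  where
  open ≤-Reasoning
  distrib : ∀ x → (1ℚ + x) * ½ ≡ x * ½ + ½
  distrib = solve-∀ ℚ-ring

H-unbounded : ∀ K → fromℕ K ≤ H (2 ℕ.^ (K ℕ.+ K))
H-unbounded K = subst (_≤ H (2 ℕ.^ (K ℕ.+ K))) double-half (H-2^-≥ (K ℕ.+ K))
  where
  cancel : ∀ x → (x + x) * ½ ≡ x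
  cancel = solve-∀ ℚ-ring
  double-half : fromℕ (K ℕ.+ K) * ½ ≡ fromℕ K
  double-half = trans (cong (_* ½) (fromℕ-+ K K)) (cancel (fromℕ K))

-- The partial sums of the constant

Δ : ℕ → ℕ → ℚ
Δ m j = pow (H (suc j)) m - pow (H j) m

constPartial-zero : ∀ m → constPartial m 0 ≡ 0ℚ
constPartial-zero m = trans (sumBelow-cong m (λ k _ → *-zeroʳ (fromℕ (m C k) * altsign (m ∸ k ∸ 1) * ½))) (sumBelow-0 m)

constPartial-suc : ∀ k L → constPartial (suc k) (suc L) ≡ constPartial (suc k) L + altsign L * (½ * Δ (suc k) L)
constPartial-suc k L = begin
  constPartial m (suc L)                                        ≡⟨ sumBelow-cong m (λ i _ → split (c i) (altsign (m ∸ i ∸ 1)) (Jpartial i (m ∸ i) L) (altsign L) (pow X i) (pow U (m ∸ i))) ⟩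
  sumBelow m (λ i → c i * altsign (m ∸ i ∸ 1) * ½ * Jpartial i (m ∸ i) L + ½ * altsign L * f i)
                                                                ≡⟨ sumBelow-+ m _ _ ⟩
  constPartial m L + sumBelow m (λ i → ½ * altsign L * f i)     ≡⟨ cong (constPartial m L +_) (sumBelow-*ˡ m (½ * altsign L) f) ⟩
  constPartial m L + ½ * altsign L * sumBelow m f               ≡⟨ cong (λ x → constPartial m L + ½ * altsign L * x) (binomial-difference k X U) ⟩
  constPartial m L + ½ * altsign L * (pow X m - pow (X - U) m)  ≡⟨ cong (λ x → constPartial m L + ½ * altsign L * (pow X m - pow x m)) (add-sub (H L) U) ⟩
  constPartial m L + ½ * altsign L * Δ m L                      ≡⟨ cong (constPartial m L +_) (*-comm-assoc ½ (altsign L) (Δ m L)) ⟩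
  constPartial m L + altsign L * (½ * Δ m L)                    ∎
  where
  open ≡-Reasoning
  m = suc k
  X = H (suc L)
  U = unitFrac L
  c : ℕ → ℚ
  c i = fromℕ (m C i)
  f : ℕ → ℚ
  f i = c i * altsign (m ∸ i ∸ 1) * pow X i * pow U (m ∸ i)
  split : ∀ c a J s P Q → c * a * ½ * (J + - - s * P * Q) ≡ c * a * ½ * J + ½ * s * (c * a * P * Q)
  split = solve-∀ ℚ-ring
  add-sub : ∀ h v → h + v - v ≡ h
  add-sub = solve-∀ ℚ-ring
  *-comm-assoc : ∀ a b c → a * b * c ≡ b * (a * c)
  *-comm-assoc = solve-∀ ℚ-ring

regularised : ℕ → ℕ → ℚ
regularised m N = altHarmSum m N - mainTerm m N

regularised-suc : ∀ m N → regularised m (suc N) ≡ regularised m N + altsign (suc N) * (½ * Δ m (suc N))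
regularised-suc m N = step (altHarmSum m N) (altsign (suc N)) (pow (H (suc N)) m) (pow (H (suc (suc N))) m)
  where
  step : ∀ S s a₁ a₂ → S + - s * a₁ - - s * ½ * a₂ ≡ S - s * ½ * a₁ + s * (½ * (a₂ - a₁))
  step = solve-∀ ℚ-ring

constPartial≡regularised : ∀ k N → constPartial (suc k) (suc N) ≡ regularised (suc k) N
constPartial≡regularised k zero = begin
  constPartial (suc k) 1                    ≡⟨ constPartial-suc k 0 ⟩
  constPartial (suc k) 0 + 1ℚ * (½ * (pow (H 1) (suc k) - pow 0ℚ (suc k)))
                                            ≡⟨ cong₂ (λ x y → x + 1ℚ * (½ * (pow (H 1) (suc k) - y))) (constPartial-zero (suc k)) (*-zeroˡ (pow 0ℚ k)) ⟩
  0ℚ + 1ℚ * (½ * (pow (H 1) (suc k) - 0ℚ))  ≡⟨ first-term (pow (H 1) (suc k)) ⟩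
  regularised (suc k) 0                     ∎
  where
  open ≡-Reasoning
  first-term : ∀ a → 0ℚ + 1ℚ * (½ * (a - 0ℚ)) ≡ 0ℚ - - 1ℚ * ½ * a
  first-term = solve-∀ ℚ-ring
constPartial≡regularised k (suc N) = begin
  constPartial (suc k) (suc (suc N))                                        ≡⟨ constPartial-suc k (suc N) ⟩
  constPartial (suc k) (suc N) + altsign (suc N) * (½ * Δ (suc k) (suc N))  ≡⟨ cong (_+ altsign (suc N) * (½ * Δ (suc k) (suc N))) (constPartial≡regularised k N) ⟩
  regularised (suc k) N + altsign (suc N) * (½ * Δ (suc k) (suc N))         ≡⟨ regularised-suc (suc k) N ⟨
  regularised (suc k) (suc N)                                               ∎
  where open ≡-Reasoning

-- The differences Δ decrease eventually

pow-suc-+-≤ : ∀ k {b δ} → 0ℚ ≤ b → 0ℚ ≤ δ →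
  pow (b + δ) (suc k) ≤ pow b (suc k) + fromℕ (suc k) * δ * pow (b + δ) k
pow-suc-+-≤ zero    {b} {δ} 0≤b 0≤δ = ≤-reflexive (linear b δ)
  where
  linear : ∀ b δ → (b + δ) * 1ℚ ≡ b * 1ℚ + 1ℚ * δ * 1ℚ
  linear = solve-∀ ℚ-ring
pow-suc-+-≤ (suc k) {b} {δ} 0≤b 0≤δ = begin
  c * pow c (suc k)                                              ≤⟨ *-monoˡ-≤-0≤ 0≤c (pow-suc-+-≤ k 0≤b 0≤δ) ⟩
  c * (pow b (suc k) + I * δ * pow c k)                          ≤⟨ p≤p+q (*-nonNeg 0≤δ (p≤q⇒0≤q-p b^k≤c^k)) ⟩
  c * (pow b (suc k) + I * δ * pow c k)
    + δ * (pow c (suc k) - pow b (suc k))                        ≡⟨ expand b δ (pow b (suc k)) (pow c k) I ⟩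
  b * pow b (suc k) + (1ℚ + I) * δ * pow c (suc k)               ≡⟨ cong (λ x → b * pow b (suc k) + x * δ * pow c (suc k)) (fromℕ-suc (suc k)) ⟨
  pow b (suc (suc k)) + fromℕ (suc (suc k)) * δ * pow c (suc k)  ∎
  where
  open ≤-Reasoning
  c = b + δ
  I = fromℕ (suc k)
  0≤c = +-nonNeg 0≤b 0≤δ
  b^k≤c^k : pow b (suc k) ≤ pow c (suc k)
  b^k≤c^k = pow-mono-≤ (suc k) 0≤b (p≤p+q 0≤δ)
  expand : ∀ b δ B P I → (b + δ) * (B + I * δ * P) + δ * ((b + δ) * P - B) ≡ b * B + (1ℚ + I) * δ * ((b + δ) * P)
  expand = solve-∀ ℚ-ring

pow-suc-+-≥ : ∀ k {b δ} → 0ℚ ≤ b → 0ℚ ≤ δ →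
  pow b (suc k) + fromℕ (suc k) * δ * pow b k ≤ pow (b + δ) (suc k)
pow-suc-+-≥ zero    {b} {δ} 0≤b 0≤δ = ≤-reflexive (linear b δ)
  where
  linear : ∀ b δ → b * 1ℚ + 1ℚ * δ * 1ℚ ≡ (b + δ) * 1ℚ
  linear = solve-∀ ℚ-ring
pow-suc-+-≥ (suc k) {b} {δ} 0≤b 0≤δ = begin
  b * pow b (suc k) + fromℕ (suc (suc k)) * δ * pow b (suc k)  ≡⟨ cong (λ x → b * pow b (suc k) + x * δ * pow b (suc k)) (fromℕ-suc (suc k)) ⟩
  b * (b * R) + (1ℚ + I) * δ * (b * R)                         ≤⟨ p≤p+q (*-nonNeg (*-nonNeg (*-nonNeg (fromℕ-nonNeg (suc k)) 0≤δ) 0≤δ) (pow-nonNeg k 0≤b)) ⟩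
  b * (b * R) + (1ℚ + I) * δ * (b * R) + I * δ * δ * R         ≡⟨ expand b δ R I ⟩
  (b + δ) * (b * R + I * δ * R)                                ≤⟨ *-monoˡ-≤-0≤ (+-nonNeg 0≤b 0≤δ) (pow-suc-+-≥ k 0≤b 0≤δ) ⟩
  (b + δ) * pow (b + δ) (suc k)                                ∎
  where
  open ≤-Reasoning
  R = pow b k
  I = fromℕ (suc k)
  expand : ∀ b δ R I → b * (b * R) + (1ℚ + I) * δ * (b * R) + I * δ * δ * R ≡ (b + δ) * (b * R + I * δ * R)
  expand = solve-∀ ℚ-ring

-- (1 + x)^k ≤ 1 + 2kx for 0 ≤ 2kx ≤ 1, in homogeneous form.
pow-+-≤-linear : ∀ k {y w} → 0ℚ ≤ y → 0ℚ ≤ w → fromℕ k * (w + w) ≤ y →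
  y * pow (y + w) k ≤ pow y k * (y + fromℕ k * (w + w))
pow-+-≤-linear zero    {y} {w} 0≤y 0≤w _ = ≤-reflexive (trivial y w)
  where
  trivial : ∀ y w → y * 1ℚ ≡ 1ℚ * (y + 0ℚ * (w + w))
  trivial = solve-∀ ℚ-ring
pow-+-≤-linear (suc k) {y} {w} 0≤y 0≤w [k+1]2w≤y = begin
  y * ((y + w) * pow (y + w) k)          ≡⟨ *-left-comm y (y + w) (pow (y + w) k) ⟩
  (y + w) * (y * pow (y + w) k)          ≤⟨ *-monoˡ-≤-0≤ (+-nonNeg 0≤y 0≤w) (pow-+-≤-linear k 0≤y 0≤w k2w≤y) ⟩
  (y + w) * (Y * (y + I * (w + w)))      ≤⟨ p≤p+q (*-nonNeg (*-nonNeg (pow-nonNeg k 0≤y) 0≤w) (p≤q⇒0≤q-p k2w≤y)) ⟩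
  (y + w) * (Y * (y + I * (w + w)))
    + Y * w * (y - I * (w + w))          ≡⟨ expand y w Y I ⟩
  y * Y * (y + (1ℚ + I) * (w + w))       ≡⟨ cong (λ x → y * Y * (y + x * (w + w))) (fromℕ-suc k) ⟨
  y * Y * (y + fromℕ (suc k) * (w + w))  ∎
  where
  open ≤-Reasoning
  Y = pow y k
  I = fromℕ k
  k2w≤y : I * (w + w) ≤ y
  k2w≤y = ≤-trans (*-monoʳ-≤-0≤ (+-nonNeg 0≤w 0≤w) (fromℕ-mono-≤ (ℕ.n≤1+n k))) [k+1]2w≤y
  *-left-comm : ∀ a b c → a * (b * c) ≡ b * (a * c)
  *-left-comm = solve-∀ ℚ-ring
  expand : ∀ y w Y I → (y + w) * (Y * (y + I * (w + w))) + Y * w * (y - I * (w + w)) ≡ y * Y * (y + (1ℚ + I) * (w + w))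
  expand = solve-∀ ℚ-ring

Δ-nonNeg : ∀ m j → 0ℚ ≤ Δ m j
Δ-nonNeg m j = p≤q⇒0≤q-p (pow-mono-≤ m (H-nonNeg j) (H-mono-≤ (ℕ.n≤1+n j)))

Δ-≤ : ∀ k j → Δ (suc k) j ≤ fromℕ (suc k) * unitFrac j * pow (H (suc j)) k
Δ-≤ k j = p≤q+r⇒p-q≤r (pow-suc-+-≤ k (H-nonNeg j) (unitFrac-nonNeg j))

Δ-≥ : ∀ k j → fromℕ (suc k) * unitFrac j * pow (H j) k ≤ Δ (suc k) j
Δ-≥ k j = q+r≤p⇒r≤p-q (pow-suc-+-≥ k (H-nonNeg j) (unitFrac-nonNeg j))

unitFrac-suc-*-≤ : ∀ k j {y} → fromℕ k * fromℕ 4 ≤ y →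
  let w = unitFrac j + unitFrac (suc j) in
  unitFrac (suc j) * (y + fromℕ k * (w + w)) ≤ unitFrac j * y
unitFrac-suc-*-≤ k j {y} 4k≤y = begin
  v * (y + I * (w + w))            ≤⟨ p≤p+q (+-nonNeg 0≤A 0≤B) ⟩
  v * (y + I * (w + w)) + (A + B)  ≡⟨ expand U v y I ⟩
  U * y - y * (U - v - U * v)      ≡⟨ cong (λ x → U * y - y * (x - U * v)) (unitFrac-difference j) ⟩
  U * y - y * (U * v - U * v)      ≡⟨ cancel U v y ⟩
  U * y                            ∎
  where
  open ≤-Reasoning
  U = unitFrac j
  v = unitFrac (suc j)
  w = U + v
  I = fromℕ k
  A = v * (I * (U - v) + I * (U - v))
  B = v * U * (y - I * fromℕ 4)
  0≤U-v : 0ℚ ≤ U - v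
  0≤U-v = p≤q⇒0≤q-p (unitFrac-antimono-≤ (ℕ.n≤1+n j))
  0≤I[U-v] : 0ℚ ≤ I * (U - v)
  0≤I[U-v] = *-nonNeg (fromℕ-nonNeg k) 0≤U-v
  0≤A : 0ℚ ≤ A
  0≤A = *-nonNeg (unitFrac-nonNeg (suc j)) (+-nonNeg 0≤I[U-v] 0≤I[U-v])
  0≤B : 0ℚ ≤ B
  0≤B = *-nonNeg (*-nonNeg (unitFrac-nonNeg (suc j)) (unitFrac-nonNeg j)) (p≤q⇒0≤q-p 4k≤y)
  expand : ∀ U v y I → v * (y + I * ((U + v) + (U + v))) + (v * (I * (U - v) + I * (U - v)) + v * U * (y - I * (ℤ.+ 4 / 1)))
                       ≡ U * y - y * (U - v - U * v)
  expand = solve-∀ ℚ-ring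
  cancel : ∀ U v y → U * y - y * (U * v - U * v) ≡ U * y
  cancel = solve-∀ ℚ-ring

unitFrac-*-pow-H-step : ∀ k j → fromℕ (k ℕ.* 4) < H j →
  unitFrac (suc j) * pow (H (suc (suc j))) k ≤ unitFrac j * pow (H j) k
unitFrac-*-pow-H-step k j 4k<y = *-cancelˡ-≤-0< 0<y (begin
  y * (v * pow (y + U + v) k)  ≡⟨ cong (λ x → y * (v * pow x k)) (+-assoc y U v) ⟩
  y * (v * pow (y + w) k)      ≡⟨ *-left-comm y v (pow (y + w) k) ⟩
  v * (y * pow (y + w) k)      ≤⟨ *-monoˡ-≤-0≤ 0≤v (pow-+-≤-linear k 0≤y 0≤w 2kw≤y) ⟩
  v * (Y * (y + I * (w + w)))  ≡⟨ *-left-comm v Y (y + I * (w + w)) ⟩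
  Y * (v * (y + I * (w + w)))  ≤⟨ *-monoˡ-≤-0≤ (pow-nonNeg k 0≤y) (unitFrac-suc-*-≤ k j 4k≤y) ⟩
  Y * (U * y)                  ≡⟨ rotate Y U y ⟩
  y * (U * Y)                  ∎)
  where
  open ≤-Reasoning
  y = H j
  U = unitFrac j
  v = unitFrac (suc j)
  w = U + v
  Y = pow y k
  I = fromℕ k
  0≤y = H-nonNeg j
  0≤v = unitFrac-nonNeg (suc j)
  0≤w = +-nonNeg (unitFrac-nonNeg j) 0≤v
  0≤I = fromℕ-nonNeg k
  0<y : 0ℚ < y
  0<y = ≤-<-trans (fromℕ-nonNeg (k ℕ.* 4)) 4k<y
  4k≤y : I * fromℕ 4 ≤ y
  4k≤y = ≤-trans (≤-reflexive (sym (fromℕ-* k 4))) (<⇒≤ 4k<y)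
  w+w≤4 : w + w ≤ fromℕ 4
  w+w≤4 = +-mono-≤ (+-mono-≤ (unitFrac≤1 j) (unitFrac≤1 (suc j))) (+-mono-≤ (unitFrac≤1 j) (unitFrac≤1 (suc j)))
  2kw≤y : I * (w + w) ≤ y
  2kw≤y = ≤-trans (*-monoˡ-≤-0≤ 0≤I w+w≤4) 4k≤y
  *-left-comm : ∀ a b c → a * (b * c) ≡ b * (a * c)
  *-left-comm = solve-∀ ℚ-ring
  rotate : ∀ a b c → a * (b * c) ≡ c * (b * a)
  rotate = solve-∀ ℚ-ring

Δ-antitone : ∀ k j → fromℕ (k ℕ.* 4) < H j → Δ (suc k) (suc j) ≤ Δ (suc k) j
Δ-antitone k j 4k<H = begin
  Δ (suc k) (suc j)                                 ≤⟨ Δ-≤ k (suc j) ⟩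
  I * unitFrac (suc j) * pow (H (suc (suc j))) k    ≡⟨ *-assoc I _ _ ⟩
  I * (unitFrac (suc j) * pow (H (suc (suc j))) k)  ≤⟨ *-monoˡ-≤-0≤ (fromℕ-nonNeg (suc k)) (unitFrac-*-pow-H-step k j 4k<H) ⟩
  I * (unitFrac j * pow (H j) k)                    ≡⟨ *-assoc I _ _ ⟨
  I * unitFrac j * pow (H j) k                      ≤⟨ Δ-≥ k j ⟩
  Δ (suc k) j                                       ∎
  where
  open ≤-Reasoning
  I = fromℕ (suc k)

-- The differences Δ tend to zero

n<2^n : ∀ n → n ℕ.< 2 ℕ.^ n
n<2^n zero    = s≤s z≤n
n<2^n (suc n) = subst (suc (suc n) ℕ.≤_) (sym (2^-suc n)) (ℕ.+-mono-≤ (ℕ.m^n>0 2 n) (n<2^n n))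

linear≤2^ : ∀ a b → ∃ λ p → a ℕ.+ b ℕ.* p ℕ.≤ 2 ℕ.^ p
linear≤2^ a b = q ℕ.+ q , (begin
  a ℕ.+ b ℕ.* (q ℕ.+ q)                ≤⟨ ℕ.+-monoˡ-≤ (b ℕ.* (q ℕ.+ q)) (ℕ.m≤n*m a q) ⟩
  q ℕ.* a ℕ.+ b ℕ.* (q ℕ.+ q)          ≤⟨ ℕ.m≤n+m _ q ⟩
  q ℕ.+ (q ℕ.* a ℕ.+ b ℕ.* (q ℕ.+ q))  ≡⟨ expand a b q ⟩
  q ℕ.* q                              ≤⟨ ℕ.*-mono-≤ (ℕ.<⇒≤ (n<2^n q)) (ℕ.<⇒≤ (n<2^n q)) ⟩
  2 ℕ.^ q ℕ.* 2 ℕ.^ q                  ≡⟨ ℕ.^-distribˡ-+-* 2 q q ⟨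
  2 ℕ.^ (q ℕ.+ q)                      ∎)
  where
  open ℕ.≤-Reasoning
  q = suc (a ℕ.+ b ℕ.+ b)
  expand : ∀ a b q → q ℕ.+ (q ℕ.* a ℕ.+ b ℕ.* (q ℕ.+ q)) ≡ q ℕ.* (1 ℕ.+ a ℕ.+ b ℕ.+ b)
  expand = ℕ-Solver.solve-∀

poly≤2^ : ∀ c k B → ∃ λ i → B ℕ.≤ i × c ℕ.* suc i ℕ.^ k ℕ.≤ 2 ℕ.^ i
poly≤2^ c k B with linear≤2^ (c ℕ.+ k ℕ.+ B) k
... | p , linear≤ = i , ℕ.≤-trans (ℕ.m≤n+m B _) exponent+B≤i , bound
  where
  open ℕ.≤-Reasoning
  i = 2 ℕ.^ p
  rearrange : ∀ c k B p → c ℕ.+ k ℕ.+ B ℕ.+ k ℕ.* p ≡ c ℕ.+ (1 ℕ.+ p) ℕ.* k ℕ.+ B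
  rearrange = ℕ-Solver.solve-∀
  exponent+B≤i : c ℕ.+ suc p ℕ.* k ℕ.+ B ℕ.≤ i
  exponent+B≤i = subst (ℕ._≤ i) (rearrange c k B p) linear≤
  suc-i≤ : suc i ℕ.≤ 2 ℕ.^ suc p
  suc-i≤ = subst (suc i ℕ.≤_) (sym (2^-suc p)) (ℕ.+-monoˡ-≤ i (ℕ.m^n>0 2 p))
  bound : c ℕ.* suc i ℕ.^ k ℕ.≤ 2 ℕ.^ i
  bound = begin
    c ℕ.* suc i ℕ.^ k                ≤⟨ ℕ.*-mono-≤ (ℕ.<⇒≤ (n<2^n c)) (ℕ.^-monoˡ-≤ k suc-i≤) ⟩
    2 ℕ.^ c ℕ.* (2 ℕ.^ suc p) ℕ.^ k  ≡⟨ cong (2 ℕ.^ c ℕ.*_) (ℕ.^-*-assoc 2 (suc p) k) ⟩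
    2 ℕ.^ c ℕ.* 2 ℕ.^ (suc p ℕ.* k)  ≡⟨ ℕ.^-distribˡ-+-* 2 c (suc p ℕ.* k) ⟨
    2 ℕ.^ (c ℕ.+ suc p ℕ.* k)        ≤⟨ ℕ.^-monoʳ-≤ 2 (ℕ.≤-trans (ℕ.m≤m+n _ B) exponent+B≤i) ⟩
    2 ℕ.^ i                          ∎

-- ε = (a + 1) / (d + 1) exceeds 1 / (d + 2).
unitFrac-archimedean : ∀ {ε} → 0ℚ < ε → ∃ λ Q → unitFrac Q < ε
unitFrac-archimedean {mkℚ ℤ.+[1+ a ] d _} _ = suc d , toℚᵘ-cancel-<
  (ℚᵘ.<-respˡ-≃ (ℚᵘ.≃-sym (toℚᵘ-unitFrac (suc d))) (ℚᵘ.*<* (ℤ.+<+ (s≤s (ℕ.+-monoʳ-≤ (suc d) z≤n)))))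
unitFrac-archimedean {mkℚ (ℤ.+ 0)     _ _} (*<* (ℤ.+<+ ()))
unitFrac-archimedean {mkℚ ℤ.-[1+ _ ] _ _} (*<* ())

unitFrac-*-fromℕ-≤ : ∀ j Q c → c ℕ.* suc Q ℕ.≤ suc j → unitFrac j * fromℕ c ≤ unitFrac Q
unitFrac-*-fromℕ-≤ j Q c c[Q+1]≤j+1 = begin
  U * fromℕ c                        ≡⟨ *-identityʳ (U * fromℕ c) ⟨
  U * fromℕ c * 1ℚ                   ≡⟨ cong (U * fromℕ c *_) (unitFrac-inverse Q) ⟨
  U * fromℕ c * (V * fromℕ (suc Q))  ≡⟨ regroup U (fromℕ c) V (fromℕ (suc Q)) ⟩
  U * V * (fromℕ c * fromℕ (suc Q))  ≡⟨ cong (U * V *_) (fromℕ-* c (suc Q)) ⟨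
  U * V * fromℕ (c ℕ.* suc Q)        ≤⟨ *-monoˡ-≤-0≤ (*-nonNeg (unitFrac-nonNeg j) (unitFrac-nonNeg Q)) (fromℕ-mono-≤ c[Q+1]≤j+1) ⟩
  U * V * fromℕ (suc j)              ≡⟨ regroup′ U V (fromℕ (suc j)) ⟩
  V * (U * fromℕ (suc j))            ≡⟨ cong (V *_) (unitFrac-inverse j) ⟩
  V * 1ℚ                             ≡⟨ *-identityʳ V ⟩
  V                                  ∎
  where
  open ≤-Reasoning
  U = unitFrac j
  V = unitFrac Q
  regroup : ∀ a b c d → a * b * (c * d) ≡ a * c * (b * d)
  regroup = solve-∀ ℚ-ring
  regroup′ : ∀ a b c → a * b * c ≡ b * (a * c)
  regroup′ = solve-∀ ℚ-ring

Δ-at-2^-≤ : ∀ k Q i → suc k ℕ.* suc Q ℕ.* suc i ℕ.^ k ℕ.≤ 2 ℕ.^ i →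
  Δ (suc k) (ℕ.pred (2 ℕ.^ i)) ≤ unitFrac Q
Δ-at-2^-≤ k Q i c≤2^i = begin
  Δ (suc k) j                                ≤⟨ Δ-≤ k j ⟩
  fromℕ (suc k) * U * pow (H (suc j)) k      ≤⟨ *-monoˡ-≤-0≤ 0≤[k+1]U (pow-mono-≤ k (H-nonNeg (suc j)) H≤i+1) ⟩
  fromℕ (suc k) * U * pow (fromℕ (suc i)) k  ≡⟨ cong (fromℕ (suc k) * U *_) (fromℕ-^ (suc i) k) ⟨
  fromℕ (suc k) * U * fromℕ (suc i ℕ.^ k)    ≡⟨ swap (fromℕ (suc k)) U (fromℕ (suc i ℕ.^ k)) ⟩
  U * (fromℕ (suc k) * fromℕ (suc i ℕ.^ k))  ≡⟨ cong (U *_) (fromℕ-* (suc k) (suc i ℕ.^ k)) ⟨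
  U * fromℕ (suc k ℕ.* suc i ℕ.^ k)          ≤⟨ unitFrac-*-fromℕ-≤ j Q (suc k ℕ.* suc i ℕ.^ k) c≤suc-j ⟩
  unitFrac Q                                 ∎
  where
  open ≤-Reasoning
  j = ℕ.pred (2 ℕ.^ i)
  U = unitFrac j
  0≤[k+1]U : 0ℚ ≤ fromℕ (suc k) * U
  0≤[k+1]U = *-nonNeg (fromℕ-nonNeg (suc k)) (unitFrac-nonNeg j)
  suc-j≡2^i : suc j ≡ 2 ℕ.^ i
  suc-j≡2^i = ℕ.suc-pred (2 ℕ.^ i) {{ℕ.m^n≢0 2 i}}
  H≤i+1 : H (suc j) ≤ fromℕ (suc i)
  H≤i+1 = subst (λ n → H n ≤ fromℕ (suc i)) (sym suc-j≡2^i) (H-2^-≤ i)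
  rearrange : ∀ a b c → a ℕ.* c ℕ.* b ≡ a ℕ.* b ℕ.* c
  rearrange = ℕ-Solver.solve-∀
  c≤suc-j : suc k ℕ.* suc i ℕ.^ k ℕ.* suc Q ℕ.≤ suc j
  c≤suc-j = subst₂ ℕ._≤_ (sym (rearrange (suc k) (suc Q) (suc i ℕ.^ k))) (sym suc-j≡2^i) c≤2^i
  swap : ∀ a b c → a * b * c ≡ b * (a * c)
  swap = solve-∀ ℚ-ring

Δ-small : ∀ k {ε} → 0ℚ < ε → ∀ B → ∃ λ j → B ℕ.≤ j × Δ (suc k) j < ε
Δ-small k 0<ε B =
  let (Q , 1/[Q+1]<ε)   = unitFrac-archimedean 0<ε
      (i , B≤i , c≤2^i) = poly≤2^ (suc k ℕ.* suc Q) k B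
  in  ℕ.pred (2 ℕ.^ i)
    , ℕ.suc[m]≤n⇒m≤pred[n] (ℕ.≤-<-trans B≤i (n<2^n i))
    , ≤-<-trans (Δ-at-2^-≤ k Q i c≤2^i) 1/[Q+1]<ε

-- Alternating series

Cauchy : (ℕ → ℚ) → Set
Cauchy e = ∀ ε → 0ℚ < ε → ∃ λ N₀ → ∀ N M → N₀ ℕ.≤ N → N₀ ℕ.≤ M → ∣ e N - e M ∣ < ε

module AlternatingSeries
  (e t : ℕ → ℚ) (e-suc : ∀ N → e (suc N) ≡ e N + altsign (suc N) * t (suc N))
  (t-nonNeg : ∀ n → 0ℚ ≤ t n) (n₀ : ℕ) (t-antitone : ∀ n → n₀ ℕ.≤ n → t (suc n) ≤ t n)
  where

  altTail : ℕ → ℕ → ℚ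
  altTail p zero    = 0ℚ
  altTail p (suc l) = t p - altTail (suc p) l

  altTail-suc : ∀ l p → altTail p (suc l) ≡ altTail p l + altsign l * t (l ℕ.+ p)
  altTail-suc zero    p = last (t p)
    where
    last : ∀ x → x - 0ℚ ≡ 0ℚ + 1ℚ * x
    last = solve-∀ ℚ-ring
  altTail-suc (suc l) p = begin
    t p - altTail (suc p) (suc l)                            ≡⟨ cong (_-_ (t p)) (altTail-suc l (suc p)) ⟩
    t p - (altTail (suc p) l + altsign l * t (l ℕ.+ suc p))  ≡⟨ regroup (t p) (altTail (suc p) l) (altsign l) (t (l ℕ.+ suc p)) ⟩
    t p - altTail (suc p) l + - altsign l * t (l ℕ.+ suc p)  ≡⟨ cong (λ n → altTail p (suc l) + - altsign l * t n) (ℕ.+-suc l p) ⟩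
    altTail p (suc l) + altsign (suc l) * t (suc l ℕ.+ p)    ∎
    where
    open ≡-Reasoning
    regroup : ∀ x T s y → x - (T + s * y) ≡ x - T + - s * y
    regroup = solve-∀ ℚ-ring

  e-+ : ∀ l N → e (l ℕ.+ N) ≡ e N + altsign (suc N) * altTail (suc N) l
  e-+ zero    N = no-terms (e N) (altsign (suc N))
    where
    no-terms : ∀ x s → x ≡ x + s * 0ℚ
    no-terms = solve-∀ ℚ-ring
  e-+ (suc l) N = begin
    e (suc (l ℕ.+ N))                                              ≡⟨ e-suc (l ℕ.+ N) ⟩
    e (l ℕ.+ N) + altsign (suc (l ℕ.+ N)) * t (suc (l ℕ.+ N))      ≡⟨ cong (λ n → e (l ℕ.+ N) + altsign n * t n) (ℕ.+-suc l N) ⟨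
    e (l ℕ.+ N) + altsign (l ℕ.+ suc N) * t (l ℕ.+ suc N)          ≡⟨ cong₂ (λ x σ → x + σ * t (l ℕ.+ suc N)) (e-+ l N) (altsign-+ l (suc N)) ⟩
    e N + s * altTail (suc N) l + altsign l * s * t (l ℕ.+ suc N)  ≡⟨ factor (e N) s (altTail (suc N) l) (altsign l) (t (l ℕ.+ suc N)) ⟩
    e N + s * (altTail (suc N) l + altsign l * t (l ℕ.+ suc N))    ≡⟨ cong (λ x → e N + s * x) (altTail-suc l (suc N)) ⟨
    e N + s * altTail (suc N) (suc l)                              ∎
    where
    open ≡-Reasoning
    s = altsign (suc N)
    factor : ∀ x s T a y → x + s * T + a * s * y ≡ x + s * (T + a * y)
    factor = solve-∀ ℚ-ring

  altTail-bounds : ∀ l p → n₀ ℕ.≤ p → 0ℚ ≤ altTail p l × altTail p l ≤ t p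
  altTail-bounds zero    p _    = ≤-refl , t-nonNeg p
  altTail-bounds (suc l) p n₀≤p =
    let (0≤T , T≤t) = altTail-bounds l (suc p) (ℕ.m≤n⇒m≤1+n n₀≤p)
    in  p≤q⇒0≤q-p (≤-trans T≤t (t-antitone p n₀≤p))
      , p≤q+r⇒p-q≤r {t p} {altTail (suc p) l} (≤-trans (p≤p+q 0≤T) (≤-reflexive (+-comm (t p) _)))

  t-antitone-≤ : ∀ {a b} → n₀ ℕ.≤ a → a ℕ.≤ b → t b ≤ t a
  t-antitone-≤ {a} n₀≤a a≤b = go (ℕ.≤⇒≤′ a≤b)
    where
    go : ∀ {b} → a ℕ.≤′ b → t b ≤ t a
    go ℕ.≤′-refl          = ≤-refl
    go (ℕ.≤′-step {b} p) = ≤-trans (t-antitone b (ℕ.≤-trans n₀≤a (ℕ.≤′⇒≤ p))) (go p)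

  ∣e[l+N]-e[N]∣≤t : ∀ l N → n₀ ℕ.≤ suc N → ∣ e (l ℕ.+ N) - e N ∣ ≤ t (suc N)
  ∣e[l+N]-e[N]∣≤t l N n₀≤N+1 = begin
    ∣ e (l ℕ.+ N) - e N ∣  ≡⟨ cong (λ x → ∣ x - e N ∣) (e-+ l N) ⟩
    ∣ e N + s * T - e N ∣  ≡⟨ cong ∣_∣ (cancel (e N) (s * T)) ⟩
    ∣ s * T ∣              ≡⟨ ∣p*q∣≡∣p∣*∣q∣ s T ⟩
    ∣ s ∣ * ∣ T ∣          ≡⟨ cong₂ _*_ (∣altsign∣≡1 (suc N)) (0≤p⇒∣p∣≡p 0≤T) ⟩
    1ℚ * T                 ≡⟨ *-identityˡ T ⟩
    T                      ≤⟨ T≤t ⟩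
    t (suc N)              ∎
    where
    open ≤-Reasoning
    s = altsign (suc N)
    T = altTail (suc N) l
    bounds = altTail-bounds l (suc N) n₀≤N+1
    0≤T = proj₁ bounds
    T≤t = proj₂ bounds
    cancel : ∀ x y → x + y - x ≡ y
    cancel = solve-∀ ℚ-ring

  ∣e[M]-e[N]∣≤t[j] : ∀ {j N M} → n₀ ℕ.≤ j → j ℕ.≤ N → N ℕ.≤ M → ∣ e M - e N ∣ ≤ t j
  ∣e[M]-e[N]∣≤t[j] {j} {N} {M} n₀≤j j≤N N≤M = begin
    ∣ e M - e N ∣              ≡⟨ cong (λ n → ∣ e n - e N ∣) (ℕ.m∸n+n≡m N≤M) ⟨
    ∣ e (M ∸ N ℕ.+ N) - e N ∣  ≤⟨ ∣e[l+N]-e[N]∣≤t (M ∸ N) N (ℕ.≤-trans n₀≤j j≤N+1) ⟩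
    t (suc N)                  ≤⟨ t-antitone-≤ n₀≤j j≤N+1 ⟩
    t j                        ∎
    where
    open ≤-Reasoning
    j≤N+1 = ℕ.m≤n⇒m≤1+n j≤N

  ∣e[N]-e[M]∣≤t[j] : ∀ {j} N M → n₀ ℕ.≤ j → j ℕ.≤ N → j ℕ.≤ M → ∣ e N - e M ∣ ≤ t j
  ∣e[N]-e[M]∣≤t[j] N M n₀≤j j≤N j≤M with ℕ.≤-total N M
  ... | inj₁ N≤M = subst (_≤ _) (∣p-q∣≡∣q-p∣ (e M) (e N)) (∣e[M]-e[N]∣≤t[j] n₀≤j j≤N N≤M)
  ... | inj₂ M≤N = ∣e[M]-e[N]∣≤t[j] n₀≤j j≤M M≤N

  cauchy : (∀ ε → 0ℚ < ε → ∃ λ j → n₀ ℕ.≤ j × t j < ε) → Cauchy e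
  cauchy t-small ε 0<ε =
    let (j , n₀≤j , t[j]<ε) = t-small ε 0<ε
    in  j , λ N M j≤N j≤M → ≤-<-trans (∣e[N]-e[M]∣≤t[j] N M n₀≤j j≤N j≤M) t[j]<ε

regularised-cauchy : ∀ k → Cauchy (regularised (suc k))
regularised-cauchy k = cauchy t-small
  where
  m = suc k
  n₀ = 2 ℕ.^ (suc (k ℕ.* 4) ℕ.+ suc (k ℕ.* 4))
  t : ℕ → ℚ
  t n = ½ * Δ m n
  0≤½ : 0ℚ ≤ ½
  0≤½ = *≤* (ℤ.+≤+ z≤n)
  4k<H : ∀ {j} → n₀ ℕ.≤ j → fromℕ (k ℕ.* 4) < H j
  4k<H n₀≤j = <-≤-trans (fromℕ-mono-< (ℕ.n<1+n (k ℕ.* 4))) (≤-trans (H-unbounded (suc (k ℕ.* 4))) (H-mono-≤ n₀≤j))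
  t-nonNeg : ∀ n → 0ℚ ≤ t n
  t-nonNeg n = *-nonNeg 0≤½ (Δ-nonNeg m n)
  t-antitone : ∀ n → n₀ ℕ.≤ n → t (suc n) ≤ t n
  t-antitone n n₀≤n = *-monoˡ-≤-0≤ 0≤½ (Δ-antitone k n (4k<H n₀≤n))
  open AlternatingSeries (regularised m) t (regularised-suc m) t-nonNeg n₀ t-antitone
  halves : ∀ x → ½ * x + ½ * x ≡ x
  halves = solve-∀ ℚ-ring
  t≤Δ : ∀ n → t n ≤ Δ m n
  t≤Δ n = ≤-trans (p≤p+q (t-nonNeg n)) (≤-reflexive (halves (Δ m n)))
  t-small : ∀ ε → 0ℚ < ε → ∃ λ j → n₀ ℕ.≤ j × t j < ε
  t-small ε 0<ε = let (j , n₀≤j , Δ<ε) = Δ-small k 0<ε n₀ in j , n₀≤j , ≤-<-trans (t≤Δ j) Δ<ε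

theorem12 : (m : ℕ) → m ≥ 1 → (ε : ℚ) → 0ℚ < ε →
    ∃ λ (N₀ : ℕ) → (N M : ℕ) → N ≥ N₀ → M ≥ N₀ →
      ∣ altHarmSum m N - (mainTerm m N + constPartial m M) ∣ < ε
theorem12 (suc k) _ ε 0<ε = let (N₀ , close) = regularised-cauchy k ε 0<ε in suc N₀ , bound N₀ close
  where
  m = suc k
  regroup : ∀ S T R → S - T - R ≡ S - (T + R)
  regroup = solve-∀ ℚ-ring
  bound : ∀ N₀ → (∀ N M → N₀ ℕ.≤ N → N₀ ℕ.≤ M → ∣ regularised m N - regularised m M ∣ < ε) →
          (N M : ℕ) → N ≥ suc N₀ → M ≥ suc N₀ → ∣ altHarmSum m N - (mainTerm m N + constPartial m M) ∣ < ε
  bound N₀ close N (suc M) N>N₀ (s≤s N₀≤M) = subst (_< ε) (cong ∣_∣ same-difference) (close N M (ℕ.<⇒≤ N>N₀) N₀≤M)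
    where
    same-difference : regularised m N - regularised m M ≡ altHarmSum m N - (mainTerm m N + constPartial m (suc M))
    same-difference = trans (regroup (altHarmSum m N) (mainTerm m N) (regularised m M))
                            (cong (λ x → altHarmSum m N - (mainTerm m N + x)) (sym (constPartial≡regularised k M)))
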